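{- Let $G$ be a finite abelian group and let $f$ be an automorphism of the monoid $\mathcal{P}_{0}(G)$. If $H$ is a subgroup of $G$, then $f(H)$ is a subgroup of $G$ as well and $|f(H)|=|H|$.
   Context: For an additively written finite abelian group $G$, $\mathcal{P}_{0}(G)$ denotes the reduced power monoid of $G$: the set of all subsets of $G$ containing $0$, with the operation of setwise addition $X+Y=\{x+y : x\in X, y\in Y\}$ and identity $\{0\}$. -}

module Defs where

open import Data.Nat using (ℕ; zero; suc)
open import Data.Bool using (Bool; true; false; _∧_; _∨_; T)
open import Data.Bool.Properties using (T-∧; T-∨)
open import Data.Unit using (tt)
open import Data.Fin using (Fin; _≟_)
import Data.Fin as F
open import Data.Fin.Subset using (Subset; ∣_∣)
open import Data.Vec using (lookup; tabulate)
open import Data.Vec.Properties using (lookup∘tabulate)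
open import Data.Product using (Σ; _,_; proj₁; proj₂; _×_)
open import Data.Sum using (inj₁; inj₂)
open import Relation.Nullary.Decidable using (⌊_⌋; fromWitness)
open import Relation.Binary.PropositionalEquality using (_≡_; refl; sym; subst)
open import Algebra.Structures using (IsAbelianGroup)
open import Function using (Bijective)
open import Function.Bundles using (Equivalence)

-- A finite abelian group of order n, with carrier Fin n (every finite
-- abelian group is isomorphic to one of this form), equality being ≡.
record FinAbGroup (n : ℕ) : Set where
  field
    _+_ : Fin n → Fin n → Fin n
    0#  : Fin n
    -_  : Fin n → Fin n
    isAbelianGroup : IsAbelianGroup _≡_ _+_ 0# -_
  open IsAbelianGroup isAbelianGroup public

_∈ₛ_ : ∀ {n} → Fin n → Subset n → Set
x ∈ₛ X = T (lookup X x)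

anyFin : ∀ {n} → (Fin n → Bool) → Bool
anyFin {zero}  p = false
anyFin {suc n} p = p F.zero ∨ anyFin (λ i → p (F.suc i))

anyFin-intro : ∀ {n} (p : Fin n → Bool) (i : Fin n) → T (p i) → T (anyFin p)
anyFin-intro {suc n} p F.zero    t = Equivalence.from T-∨ (inj₁ t)
anyFin-intro {suc n} p (F.suc i) t =
  Equivalence.from T-∨ (inj₂ (anyFin-intro (λ j → p (F.suc j)) i t))

module _ {n : ℕ} (G : FinAbGroup n) where
  open FinAbGroup G using (_+_; 0#; -_; identityˡ)

  sumset : Subset n → Subset n → Subset n
  sumset X Y = tabulate λ z →
    anyFin λ x → anyFin λ y → lookup X x ∧ (lookup Y y ∧ ⌊ (x + y) ≟ z ⌋)

  P₀ : Set
  P₀ = Σ (Subset n) λ X → 0# ∈ₛ X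

  0∈sumset : (X Y : P₀) → 0# ∈ₛ sumset (proj₁ X) (proj₁ Y)
  0∈sumset (X , pX) (Y , pY) =
    subst T (sym (lookup∘tabulate _ 0#))
      (anyFin-intro _ 0# (anyFin-intro _ 0#
        (Equivalence.from T-∧ (pX , Equivalence.from T-∧
          (pY , fromWitness (identityˡ 0#))))))

  _⊕_ : P₀ → P₀ → P₀
  X ⊕ Y = sumset (proj₁ X) (proj₁ Y) , 0∈sumset X Y

  unit : P₀
  unit = tabulate (λ z → ⌊ z ≟ 0# ⌋) ,
         subst T (sym (lookup∘tabulate _ 0#)) (fromWitness refl)

  record IsAutomorphism (f : P₀ → P₀) : Set where
    field
      bijective : Bijective _≡_ _≡_ f
      hom       : ∀ X Y → f (X ⊕ Y) ≡ f X ⊕ f Y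
      hom-unit  : f unit ≡ unit

  record IsSubgroup (H : Subset n) : Set where
    field
      zero-mem : 0# ∈ₛ H
      add-mem  : ∀ {x y} → x ∈ₛ H → y ∈ₛ H → (x + y) ∈ₛ H
      neg-mem  : ∀ {x} → x ∈ₛ H → (- x) ∈ₛ H

-- A set K ∋ 0 is additively closed iff K + K = K, and then X + K = K iff X ⊆ K. An
-- automorphism f of P₀(G) preserves both equations, so f(H) is additively closed (hence a
-- subgroup, G being finite), and f restricts to a bijection between the elements of P₀(G)
-- contained in H and those contained in f(H). There are 2^(|H|-1) of the former and
-- 2^(|f(H)|-1) of the latter, so |f(H)| = |H|.
module Submission where

open import Defs
open import Algebra.Bundles using (Group)
open import Data.Bool using (Bool; true; T)
open import Data.Bool.Properties using (T-≡; T-∨; T-∧; T-irrelevant)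
open import Data.Fin using (Fin; zero; suc; toℕ; _≟_)
open import Data.Fin.Permutation using (↔⇒≡)
open import Data.Fin.Properties using (2↔Bool; *↔×; pigeonhole)
open import Data.Fin.Subset using (Subset; ∣_∣; _∈_; _⊆_; inside; outside)
open import Data.Fin.Subset.Properties using (_⊆?_; ⊆-antisym; ⊆-refl; drop-∷-⊆; out⊆; in⊆in)
open import Data.Nat using (ℕ; _^_; s≤s; z≤n)
import Data.Nat as ℕ
open import Data.Nat.Properties using (^-monoʳ-<; <⇒≢; <-cmp; n<1+n; +-suc; m≤n⇒∃[o]m+o≡n)
open import Data.Product using (Σ; ∃; ∃₂; _×_; _,_; proj₁; proj₂)
open import Data.Product.Function.Dependent.Propositional using (Σ-↔)
open import Data.Product.Function.NonDependent.Propositional using (_×-↔_)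
open import Data.Sum using (inj₁; inj₂)
open import Data.Vec using ([]; _∷_; lookup; _[_]≔_)
open import Data.Vec.Properties
  using (lookup∘tabulate; lookup⇒[]=; []=⇒lookup; lookup∘update; lookup∘update′; []≔-idempotent; []≔-lookup)
open import Function using (_∘_)
open import Function.Bundles using (_↔_; _⇔_; mk↔ₛ′; mk⇔; mk⤖; Equivalence)
open import Function.Properties.Bijection using (⤖⇒↔)
open import Function.Properties.Equivalence using () renaming (trans to ⇔-trans; sym to ⇔-sym)
open import Function.Properties.Inverse using (↔-refl; ↔-trans; ↔-sym)
open import Level using (0ℓ)
open import Relation.Binary using (tri<; tri≈; tri>)
open import Relation.Binary.PropositionalEquality
  using (_≡_; refl; sym; trans; cong; cong₂; subst; module ≡-Reasoning)
open import Relation.Nullary using (contradiction; yes; no)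
open import Relation.Nullary.Decidable using (True; toWitness; fromWitness)

2^-injective : ∀ {m n} → 2 ^ m ≡ 2 ^ n → m ≡ n
2^-injective {m} {n} e with <-cmp m n
... | tri< m<n _ _ = contradiction e (<⇒≢ (^-monoʳ-< 2 (s≤s (s≤s z≤n)) m<n))
... | tri≈ _ m≡n _ = m≡n
... | tri> _ _ n<m = contradiction (sym e) (<⇒≢ (^-monoʳ-< 2 (s≤s (s≤s z≤n)) n<m))

anyFin-elim : ∀ {n} (p : Fin n → Bool) → T (anyFin p) → ∃ λ i → T (p i)
anyFin-elim {ℕ.suc n} p t with Equivalence.to T-∨ t
... | inj₁ t₀ = zero , t₀
... | inj₂ tₛ = let i , tᵢ = anyFin-elim (p ∘ suc) tₛ in suc i , tᵢ

private variable m : ℕ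

∈ₛ⇔∈ : ∀ {x : Fin m} {X} → x ∈ₛ X ⇔ x ∈ X
∈ₛ⇔∈ {x = x} {X = X} = mk⇔ (lookup⇒[]= x X ∘ Equivalence.to T-≡)
                           (Equivalence.from T-≡ ∘ []=⇒lookup)

⊆-fromₛ : ∀ {X Y : Subset m} → (∀ {x} → x ∈ₛ X → x ∈ₛ Y) → X ⊆ Y
⊆-fromₛ X⊆Y = Equivalence.to ∈ₛ⇔∈ ∘ X⊆Y ∘ Equivalence.from ∈ₛ⇔∈

⊆-toₛ : ∀ {X Y : Subset m} {x} → X ⊆ Y → x ∈ₛ X → x ∈ₛ Y
⊆-toₛ X⊆Y = Equivalence.from ∈ₛ⇔∈ ∘ X⊆Y ∘ Equivalence.to ∈ₛ⇔∈

Subsets : Subset m → Set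
Subsets {m} H = Σ (Subset m) λ X → True (X ⊆? H)

-- Nested so that Subsets∋ 0# H is definitionally a type of elements of P₀ G.
Subsets∋ : Fin m → Subset m → Set
Subsets∋ {m} i H = Σ (Σ (Subset m) (i ∈ₛ_)) λ X → True (proj₁ X ⊆? H)

Subsets-≡ : ∀ {H : Subset m} {X Y : Subsets H} → proj₁ X ≡ proj₁ Y → X ≡ Y
Subsets-≡ {X = X , s} {Y = _ , t} refl = cong (X ,_) (T-irrelevant s t)

Subsets∋-≡ : ∀ {i} {H : Subset m} {X Y : Subsets∋ i H} → proj₁ (proj₁ X) ≡ proj₁ (proj₁ Y) → X ≡ Y
Subsets∋-≡ {X = (X , p) , s} {Y = (_ , q) , t} refl =
  cong₂ (λ p s → (X , p) , s) (T-irrelevant p q) (T-irrelevant s t)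

⊆?-cong-↔ : ∀ {X E Y F : Subset m} → X ⊆ E ⇔ Y ⊆ F → True (X ⊆? E) ↔ True (Y ⊆? F)
⊆?-cong-↔ {X = X} {E} {Y} {F} X⊆E⇔Y⊆F =
  mk↔ₛ′ (λ s → fromWitness {a? = Y ⊆? F} (to (toWitness {a? = X ⊆? E} s)))
        (λ s → fromWitness {a? = X ⊆? E} (from (toWitness {a? = Y ⊆? F} s)))
        (λ _ → T-irrelevant _ _) (λ _ → T-irrelevant _ _)
  where open Equivalence X⊆E⇔Y⊆F

Subsets↔2^∣∣ : (H : Subset m) → Subsets H ↔ Fin (2 ^ ∣ H ∣)
Subsets↔2^∣∣ [] = mk↔ₛ′ (λ _ → zero) (λ _ → [] , _) (λ { zero → refl ; (suc ()) }) (λ { ([] , _) → refl })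
Subsets↔2^∣∣ (outside ∷ H) = ↔-trans dropOutside (Subsets↔2^∣∣ H)
  where
  tail : Subsets (outside ∷ H) → Subsets H
  tail (outside ∷ X , s) = X , fromWitness (λ {x} → drop-∷-⊆ (toWitness s))

  dropOutside : Subsets (outside ∷ H) ↔ Subsets H
  dropOutside = mk↔ₛ′ tail (λ (X , s) → outside ∷ X , fromWitness (λ {x} → out⊆ (toWitness s)))
                      (λ _ → Subsets-≡ refl) (λ { (outside ∷ X , s) → Subsets-≡ refl })
Subsets↔2^∣∣ (inside ∷ H) =
  ↔-trans splitHead (↔-trans (↔-sym 2↔Bool ×-↔ Subsets↔2^∣∣ H) (↔-sym *↔×))
  where
  cons : Bool × Subsets H → Subsets (inside ∷ H)
  cons (outside , X , s) = outside ∷ X , fromWitness (λ {x} → out⊆ (toWitness s))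
  cons (inside  , X , s) = inside ∷ X , fromWitness (λ {x} → in⊆in (toWitness s))

  uncons : Subsets (inside ∷ H) → Bool × Subsets H
  uncons (b ∷ X , s) = b , X , fromWitness (λ {x} → drop-∷-⊆ (toWitness s))

  splitHead : Subsets (inside ∷ H) ↔ (Bool × Subsets H)
  splitHead = mk↔ₛ′ uncons cons
                    (λ { (outside , _) → cong (outside ,_) (Subsets-≡ refl)
                       ; (inside , _) → cong (inside ,_) (Subsets-≡ refl) })
                    (λ { (outside ∷ X , s) → Subsets-≡ refl ; (inside ∷ X , s) → Subsets-≡ refl })

Subsets↔⇒∣∣≡ : ∀ {H K : Subset m} → Subsets H ↔ Subsets K → ∣ H ∣ ≡ ∣ K ∣
Subsets↔⇒∣∣≡ {H = H} {K} H↔K =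
  2^-injective (↔⇒≡ (↔-trans (↔-sym (Subsets↔2^∣∣ H)) (↔-trans H↔K (Subsets↔2^∣∣ K))))

[]≔-⊆ : ∀ {i : Fin m} {X H} b → i ∈ H → X ⊆ H → X [ i ]≔ b ⊆ H
[]≔-⊆ {i = i} {X} b i∈H X⊆H {j} j∈X′ with j ≟ i
... | yes refl = i∈H
... | no j≢i = X⊆H (lookup⇒[]= j X (trans (sym (lookup∘update′ j≢i X b)) ([]=⇒lookup j∈X′)))

-- A subset X of H is determined by whether i ∈ X together with X ∪ {i}.
Subsets↔Bool×Subsets∋ : ∀ {i : Fin m} {H} → i ∈ₛ H → Subsets H ↔ (Bool × Subsets∋ i H)
Subsets↔Bool×Subsets∋ {i = i} {H} i∈H = mk↔ₛ′ split merge split∘merge merge∘split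
  where
  open ≡-Reasoning

  set-i : ∀ X b → X ⊆ H → Subsets H
  set-i X b X⊆H = X [ i ]≔ b , fromWitness (λ {x} → []≔-⊆ b (Equivalence.to ∈ₛ⇔∈ i∈H) X⊆H)

  split : Subsets H → Bool × Subsets∋ i H
  split (X , s) = let Y , t = set-i X true (toWitness s) in
    lookup X i , (Y , subst T (sym (lookup∘update i X true)) _) , t

  merge : Bool × Subsets∋ i H → Subsets H
  merge (b , (Y , _) , t) = set-i Y b (toWitness t)

  split∘merge : ∀ y → split (merge y) ≡ y
  split∘merge (b , (Y , i∈Y) , t) = cong₂ _,_ (lookup∘update i Y b) (Subsets∋-≡ (begin
    (Y [ i ]≔ b) [ i ]≔ true  ≡⟨ []≔-idempotent Y i ⟩
    Y [ i ]≔ true             ≡⟨ cong (Y [ i ]≔_) (Equivalence.to T-≡ i∈Y) ⟨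
    Y [ i ]≔ lookup Y i       ≡⟨ []≔-lookup Y i ⟩
    Y                         ∎))

  merge∘split : ∀ x → merge (split x) ≡ x
  merge∘split (X , _) = Subsets-≡ (trans ([]≔-idempotent X i) ([]≔-lookup X i))

module _ {n : ℕ} (G : FinAbGroup n) where
  open FinAbGroup G using (_+_; 0#; -_; isGroup; identityˡ; identityʳ)

  group : Group 0ℓ 0ℓ
  group = record { isGroup = isGroup }

  open import Algebra.Properties.Group group using (identityʳ-unique; inverseʳ-unique)
  open import Algebra.Properties.Monoid.Mult (Group.monoid group) using (×-homo-+) renaming (_×_ to _·_)

  AddClosed : Subset n → Set
  AddClosed K = ∀ {x y} → x ∈ₛ K → y ∈ₛ K → (x + y) ∈ₛ K

  ∈-sumset⁺ : ∀ X Y {x y} → x ∈ₛ X → y ∈ₛ Y → (x + y) ∈ₛ sumset G X Y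
  ∈-sumset⁺ X Y {x} {y} x∈X y∈Y = subst T (sym (lookup∘tabulate _ (x + y)))
    (anyFin-intro _ x (anyFin-intro _ y
      (Equivalence.from T-∧ (x∈X , Equivalence.from T-∧ (y∈Y , fromWitness refl)))))

  ∈-sumset⁻ : ∀ X Y {z} → z ∈ₛ sumset G X Y → ∃₂ λ x y → x ∈ₛ X × y ∈ₛ Y × x + y ≡ z
  ∈-sumset⁻ X Y {z} z∈X+Y =
    let x , x-witness = anyFin-elim _ (subst T (lookup∘tabulate _ z) z∈X+Y)
        y , xy-witness = anyFin-elim _ x-witness
        x∈X , rest = Equivalence.to T-∧ xy-witness
        y∈Y , x+y≡z = Equivalence.to T-∧ rest
    in x , y , x∈X , y∈Y , toWitness x+y≡z

  -x≡d·x : ∀ x a d → a · x ≡ (a ℕ.+ ℕ.suc d) · x → - x ≡ d · x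
  -x≡d·x x a d period = sym (inverseʳ-unique x (d · x)
    (identityʳ-unique (a · x) (ℕ.suc d · x) (trans (sym (×-homo-+ x a (ℕ.suc d))) (sym period))))

  ·-closed : ∀ {K x} → 0# ∈ₛ K → AddClosed K → x ∈ₛ K → ∀ k → (k · x) ∈ₛ K
  ·-closed 0∈K _     _   ℕ.zero    = 0∈K
  ·-closed {K} 0∈K K+K⊆K x∈K (ℕ.suc k) = K+K⊆K x∈K (·-closed {K} 0∈K K+K⊆K x∈K k)

  -- Two of the multiples 0·x, …, n·x coincide, so x has finite order and -x is a multiple of x.
  addClosed⇒isSubgroup : ∀ {K} → 0# ∈ₛ K → AddClosed K → IsSubgroup G K
  addClosed⇒isSubgroup {K} 0∈K K+K⊆K = record
    { zero-mem = 0∈K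
    ; add-mem  = K+K⊆K
    ; neg-mem  = neg-mem
    }
    where
    neg-mem : ∀ {x} → x ∈ₛ K → (- x) ∈ₛ K
    neg-mem {x} x∈K with pigeonhole (n<1+n n) (λ i → toℕ i · x)
    ... | i , j , i<j , ix≡jx with m≤n⇒∃[o]m+o≡n i<j
    ... | d , 1+i+d≡j =
      subst (_∈ₛ K) (sym (-x≡d·x x (toℕ i) d period)) (·-closed {K} 0∈K K+K⊆K x∈K d)
      where
      period : toℕ i · x ≡ (toℕ i ℕ.+ ℕ.suc d) · x
      period = trans ix≡jx (cong (_· x) (trans (sym 1+i+d≡j) (sym (+-suc (toℕ i) d))))

  infixl 6 _⊕ᴳ_
  _⊕ᴳ_ : P₀ G → P₀ G → P₀ G
  _⊕ᴳ_ = _⊕_ G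

  P₀-≡ : {X Y : P₀ G} → proj₁ X ≡ proj₁ Y → X ≡ Y
  P₀-≡ {X , p} {_ , q} refl = cong (X ,_) (T-irrelevant p q)

  ⊕-idem⇒addClosed : (K : P₀ G) → K ⊕ᴳ K ≡ K → AddClosed (proj₁ K)
  ⊕-idem⇒addClosed K K+K≡K x∈K y∈K =
    subst (λ Z → (_ + _) ∈ₛ proj₁ Z) K+K≡K (∈-sumset⁺ (proj₁ K) (proj₁ K) x∈K y∈K)

  ⊕-absorbs⇔⊆ : (X K : P₀ G) → AddClosed (proj₁ K) → X ⊕ᴳ K ≡ K ⇔ proj₁ X ⊆ proj₁ K
  ⊕-absorbs⇔⊆ X@(X₁ , 0∈X) K@(K₁ , 0∈K) K+K⊆K = mk⇔ absorbs⇒⊆ ⊆⇒absorbs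
    where
    absorbs⇒⊆ : X ⊕ᴳ K ≡ K → X₁ ⊆ K₁
    absorbs⇒⊆ X+K≡K = ⊆-fromₛ λ {x} x∈X →
      subst (λ Z → x ∈ₛ proj₁ Z) X+K≡K
        (subst (_∈ₛ sumset G X₁ K₁) (identityʳ x) (∈-sumset⁺ X₁ K₁ x∈X 0∈K))

    ⊆⇒absorbs : X₁ ⊆ K₁ → X ⊕ᴳ K ≡ K
    ⊆⇒absorbs X⊆K = P₀-≡ (⊆-antisym (⊆-fromₛ X+K⊆K) (⊆-fromₛ K⊆X+K))
      where
      X+K⊆K : ∀ {z} → z ∈ₛ sumset G X₁ K₁ → z ∈ₛ K₁
      X+K⊆K z∈X+K with ∈-sumset⁻ X₁ K₁ z∈X+K
      ... | x , y , x∈X , y∈K , refl = K+K⊆K (⊆-toₛ X⊆K x∈X) y∈K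

      K⊆X+K : ∀ {z} → z ∈ₛ K₁ → z ∈ₛ sumset G X₁ K₁
      K⊆X+K {z} z∈K = subst (_∈ₛ sumset G X₁ K₁) (identityˡ z) (∈-sumset⁺ X₁ K₁ 0∈X z∈K)

  module _ {f : P₀ G → P₀ G} (aut : IsAutomorphism G f) where
    open IsAutomorphism aut

    f-⊕-absorbs : ∀ X E → X ⊕ᴳ E ≡ E ⇔ f X ⊕ᴳ f E ≡ f E
    f-⊕-absorbs X E = mk⇔ (λ X+E≡E → trans (sym (hom X E)) (cong f X+E≡E))
                          (λ fX+fE≡fE → proj₁ bijective (trans (hom X E) fX+fE≡fE))

    f-addClosed : ∀ E → AddClosed (proj₁ E) → AddClosed (proj₁ (f E))
    f-addClosed E E-closed = ⊕-idem⇒addClosed (f E)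
      (Equivalence.to (f-⊕-absorbs E E) (Equivalence.from (⊕-absorbs⇔⊆ E E E-closed) ⊆-refl))

    -- X ⊆ E iff X + E = E, and f preserves the latter equation.
    f-Subsets∋0↔ : ∀ E → AddClosed (proj₁ E) → Subsets∋ 0# (proj₁ E) ↔ Subsets∋ 0# (proj₁ (f E))
    f-Subsets∋0↔ E E-closed = Σ-↔ (⤖⇒↔ (mk⤖ bijective)) λ {X} → ⊆?-cong-↔
      (⇔-trans (⇔-sym (⊕-absorbs⇔⊆ X E E-closed))
        (⇔-trans (f-⊕-absorbs X E) (⊕-absorbs⇔⊆ (f X) (f E) (f-addClosed E E-closed))))

    f-preserves-∣∣ : ∀ E → AddClosed (proj₁ E) → ∣ proj₁ (f E) ∣ ≡ ∣ proj₁ E ∣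
    f-preserves-∣∣ E E-closed = sym (Subsets↔⇒∣∣≡ (↔-trans (Subsets↔Bool×Subsets∋ (proj₂ E))
      (↔-trans (↔-refl ×-↔ f-Subsets∋0↔ E E-closed) (↔-sym (Subsets↔Bool×Subsets∋ (proj₂ (f E)))))))

lemma2p1 : {n : ℕ} (G : FinAbGroup n) (f : P₀ G → P₀ G) → IsAutomorphism G f →
           (H : Subset n) (sg : IsSubgroup G H) →
           IsSubgroup G (proj₁ (f (H , IsSubgroup.zero-mem sg)))
           × ∣ proj₁ (f (H , IsSubgroup.zero-mem sg)) ∣ ≡ ∣ H ∣
lemma2p1 G f aut H sg =
  addClosed⇒isSubgroup G (proj₂ (f H₀)) (f-addClosed G aut H₀ H-closed) ,
  f-preserves-∣∣ G aut H₀ H-closed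
  where
  open IsSubgroup sg
  H₀ : P₀ G
  H₀ = H , zero-mem
  H-closed : AddClosed G H
  H-closed = add-mem
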